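{- The reduction $\to_c$ is confluent: for all $M,M_1,M_2\in\mathcal{M}$, if $M\twoheadrightarrow_c M_1$ and $M\twoheadrightarrow_c M_2$ then there exists $Z\in\mathcal{M}$ with $M_1\twoheadrightarrow_c Z$ and $M_2\twoheadrightarrow_c Z$.
   Context: Addressing machines. Fix a countable set $\mathbb{A}$ of addresses and a symbol $\varnothing\notin\mathbb{A}$; put $\mathbb{A}_\varnothing=\mathbb{A}\cup\{\varnothing\}$. A tape is a finite list of elements of $\mathbb{A}$; $a::T$ has head $a$ and tail $T$, $T@T'$ is concatenation. A program is a finite list of instructions generated by $P::=\mathtt{Load}\ i;P\mid A$, $A::=\mathtt{App}(i,j,k);A\mid C$, $C::=\mathtt{Call}\ i\mid\varepsilon$ ($i,j,k\in\mathbb{N}$). For $r\in\mathbb{N}$, $I\subseteq\{0,\dots,r-1\}$, $I\models^r P$ is the least relation such that: $I\models^r\varepsilon$; $I\models^r\mathtt{Call}\ i$ if $i\in I$; $I\models^r\mathtt{App}(i,j,k);A$ if $i,j\in I$ and either ($k<r$ and $I\cup\{k\}\models^r A$) or ($k\ge r$ and $I\models^r A$); $I\models^r\mathtt{Load}\ i;P$ if either ($i<r$ and $I\cup\{i\}\models^r P$) or ($i\ge r$ and $I\models^r P$). An addressing machine is $M=\langle R_0,\dots,R_{r-1},P,T\rangle$ with registers in $\mathbb{A}_\varnothing$, $P$ valid w.r.t. the registers ($\{i<r\mid R_i\ne\varnothing\}\models^r P$), and a tape $T$; $\mathcal{M}$ is the set of all of them. $\vec R[R_i:=a]$ replaces $R_i$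 by $a$ if $i<r$ and is $\vec R$ if $i\ge r$. Fix a bijection $\#:\mathcal{M}\to\mathbb{A}$ with inverse $\#^{ -1}$; $M@T'=\langle M.\vec R,M.P,M.T@T'\rangle$; $a\cdot b=\#(\#^{ -1}(a)@[b])$. Head reduction: $\langle\vec R,\mathtt{Load}\ i;P,a::T\rangle\to_h\langle\vec R[R_i:=a],P,T\rangle$, $\langle\vec R,\mathtt{App}(i,j,k);P,T\rangle\to_h\langle\vec R[R_k:=R_i\cdot R_j],P,T\rangle$, $\langle\vec R,\mathtt{Call}\ i,T\rangle\to_h\#^{ -1}(R_i)@T$. The reduction $\to_c$ is the least relation on $\mathcal{M}$ containing $\to_h$ and closed under: if $0\le i<r$, $R_i=a\in\mathbb{A}$ and $\#^{ -1}(a)\to_c M'$, then $\langle\vec R,P,T\rangle\to_c\langle\vec R[R_i:=\#M'],P,T\rangle$; if $T=[a_0,\dots,a_n]$, $0\le i\le n$ and $\#^{ -1}(a_i)\to_c M'$, then $\langle\vec R,P,T\rangle\to_c\langle\vec R,P,[a_0,\dots,a_{i-1},\#M',a_{i+1},\dots,a_n]\rangle$. $\twoheadrightarrow_c$ is its reflexive-transitive closure. -}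

module Defs where

open import Data.Nat using (ℕ; zero; suc)
open import Data.Bool using (Bool; true; false; T)
open import Data.Maybe using (Maybe; just; nothing; is-just)
open import Data.List using (List; []; _∷_; _++_; [_])
open import Data.Vec using (Vec; []; _∷_; map)
open import Data.Fin.Subset using (Subset)
open import Data.Empty using (⊥)
open import Function.Bundles using (_↔_; Inverse)
open import Relation.Binary.PropositionalEquality using (_≡_; refl; subst; cong)
open import Relation.Binary.Construct.Closure.ReflexiveTransitive using (Star)

data CProg : Set where
  call : ℕ → CProg
  ε    : CProg

data AProg : Set where
  app  : ℕ → ℕ → ℕ → AProg → AProg
  cpr  : CProg → AProg

data Prog : Set where
  load : ℕ → Prog → Prog
  apr  : AProg → Prog

-- i ∈ I  (false / empty for i ≥ r)
_∈ₙ_ : {r : ℕ} → ℕ → Subset r → Set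
_∈ₙ_ i [] = ⊥
_∈ₙ_ zero (b ∷ I) = T b
_∈ₙ_ (suc i) (b ∷ I) = i ∈ₙ I

-- "I ∪ {k} if k < r, and I if k ≥ r"
addₙ : {r : ℕ} → ℕ → Subset r → Subset r
addₙ k [] = []
addₙ zero (b ∷ I) = true ∷ I
addₙ (suc k) (b ∷ I) = b ∷ addₙ k I

data _⊨C_ {r : ℕ} (I : Subset r) : CProg → Set where
  ⊨ε    : I ⊨C ε
  ⊨call : ∀ {i} → i ∈ₙ I → I ⊨C call i

data _⊨A_ {r : ℕ} (I : Subset r) : AProg → Set where
  ⊨cpr : ∀ {C} → I ⊨C C → I ⊨A cpr C
  ⊨app : ∀ {i j k A} → i ∈ₙ I → j ∈ₙ I → addₙ k I ⊨A A → I ⊨A app i j k A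

data _⊨P_ {r : ℕ} (I : Subset r) : Prog → Set where
  ⊨apr  : ∀ {A} → I ⊨A A → I ⊨P apr A
  ⊨load : ∀ {i P} → addₙ i I ⊨P P → I ⊨P load i P

-- Registers (nothing = ∅)

-- R_i  (nothing when i ≥ r)
_!_ : {X : Set} {r : ℕ} → Vec (Maybe X) r → ℕ → Maybe X
[] ! i = nothing
(x ∷ R) ! zero = x
(x ∷ R) ! suc i = R ! i

-- R[R_i := x]  (identity when i ≥ r)
upd : {X : Set} {r : ℕ} → ℕ → X → Vec X r → Vec X r
upd i x [] = []
upd zero x (y ∷ R) = x ∷ R
upd (suc i) x (y ∷ R) = y ∷ upd i x R

nonEmpty : {X : Set} {r : ℕ} → Vec (Maybe X) r → Subset r
nonEmpty = map is-just

_!ₗ_ : {X : Set} → List X → ℕ → Maybe X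
[] !ₗ i = nothing
(x ∷ T) !ₗ zero = just x
(x ∷ T) !ₗ suc i = T !ₗ i

updₗ : {X : Set} → ℕ → X → List X → List X
updₗ i x [] = []
updₗ zero x (y ∷ T) = x ∷ T
updₗ (suc i) x (y ∷ T) = y ∷ updₗ i x T

record Machine (A : Set) : Set where
  constructor ⟨_,_,_,_,_⟩
  field
    r      : ℕ
    R      : Vec (Maybe A) r
    P      : Prog
    .valid : nonEmpty R ⊨P P
    tape   : List A

open Machine public

_++ₘ_ : {A : Set} → Machine A → List A → Machine A
⟨ r , R , P , v , T ⟩ ++ₘ T' = ⟨ r , R , P , v , T ++ T' ⟩

nonEmpty-upd : {X : Set} {r : ℕ} (i : ℕ) (x : X) (R : Vec (Maybe X) r) →
               nonEmpty (upd i (just x) R) ≡ addₙ i (nonEmpty R)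
nonEmpty-upd i x [] = refl
nonEmpty-upd zero x (y ∷ R) = refl
nonEmpty-upd (suc i) x (y ∷ R) = cong (is-just y ∷_) (nonEmpty-upd i x R)

nonEmpty-upd-just : {X : Set} {r : ℕ} (i : ℕ) (x a : X) (R : Vec (Maybe X) r) →
                    R ! i ≡ just a → nonEmpty (upd i (just x) R) ≡ nonEmpty R
nonEmpty-upd-just i x a [] ()
nonEmpty-upd-just zero x a (.(just a) ∷ R) refl = refl
nonEmpty-upd-just (suc i) x a (y ∷ R) e = cong (is-just y ∷_) (nonEmpty-upd-just i x a R e)

load-inv : ∀ {r} {I : Subset r} {i P} → I ⊨P load i P → addₙ i I ⊨P P
load-inv (⊨load v) = v

app-inv : ∀ {r} {I : Subset r} {i j k A} → I ⊨P apr (app i j k A) → addₙ k I ⊨P apr A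
app-inv (⊨apr (⊨app _ _ v)) = ⊨apr v

module Reduction (A : Set) (hash : Machine A ↔ A) where

  # : Machine A → A
  # = Inverse.to hash

  #⁻¹ : A → Machine A
  #⁻¹ = Inverse.from hash

  _·_ : A → A → A
  a · b = # (#⁻¹ a ++ₘ [ b ])

  data _→h_ : Machine A → Machine A → Set where
    h-load : ∀ {r} (R : Vec (Maybe A) r) i P .(v : nonEmpty R ⊨P load i P) a T →
      ⟨ r , R , load i P , v , a ∷ T ⟩ →h
      ⟨ r , upd i (just a) R , P
          , subst (_⊨P P) (Relation.Binary.PropositionalEquality.sym (nonEmpty-upd i a R)) (load-inv v)
          , T ⟩
    h-app : ∀ {r} (R : Vec (Maybe A) r) i j k P .(v : nonEmpty R ⊨P apr (app i j k P)) T a b →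
      R ! i ≡ just a → R ! j ≡ just b →
      ⟨ r , R , apr (app i j k P) , v , T ⟩ →h
      ⟨ r , upd k (just (a · b)) R , apr P
          , subst (_⊨P apr P) (Relation.Binary.PropositionalEquality.sym (nonEmpty-upd k (a · b) R)) (app-inv v)
          , T ⟩
    h-call : ∀ {r} (R : Vec (Maybe A) r) i .(v : nonEmpty R ⊨P apr (cpr (call i))) T a →
      R ! i ≡ just a →
      ⟨ r , R , apr (cpr (call i)) , v , T ⟩ →h (#⁻¹ a ++ₘ T)

  data _→c_ : Machine A → Machine A → Set where
    c-head : ∀ {M M'} → M →h M' → M →c M'
    c-reg  : ∀ {r} (R : Vec (Maybe A) r) P .(v : nonEmpty R ⊨P P) T i a M' →
      (e : R ! i ≡ just a) → #⁻¹ a →c M' →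
      ⟨ r , R , P , v , T ⟩ →c
      ⟨ r , upd i (just (# M')) R , P
          , subst (_⊨P P) (Relation.Binary.PropositionalEquality.sym (nonEmpty-upd-just i (# M') a R e)) v
          , T ⟩
    c-tape : ∀ {r} (R : Vec (Maybe A) r) P .(v : nonEmpty R ⊨P P) T i a M' →
      T !ₗ i ≡ just a → #⁻¹ a →c M' →
      ⟨ r , R , P , v , T ⟩ →c ⟨ r , R , P , v , updₗ i (# M') T ⟩

  _↠c_ : Machine A → Machine A → Set
  _↠c_ = Star _→c_

{-# OPTIONS --safe #-}
-- Tait and Martin-Löf's parallel-reduction method. A parallel step M ⇉ N first rewrites
-- every register and tape cell of M simultaneously, each address a either kept or replaced
-- by # N′ for a parallel step #⁻¹ a ⇉ N′ (this is a ⇛ b), and then performs at most one head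
-- step. Then →c ⊆ ⇉ ⊆ ↠c, and ⇉ has the diamond property: two inner rewritings are joined
-- cell by cell, and a head step commutes with an inner rewriting because it only reads
-- register contents and the tape head, which the rewriting changes up to ⇛ (and ⇛ is a
-- congruence for ·); two head steps from the joined machine coincide by determinism.

module Submission where

open import Defs
open import Data.Nat using (ℕ; zero; suc)
open import Data.Product using (Σ; ∃; _×_; _,_)
open import Function.Base using (id)
open import Function.Bundles using (_↣_; _↔_; Inverse)
open import Data.Maybe using (Maybe; just; nothing; is-just)
open import Data.List using (List; []; _∷_; _++_)
open import Data.List.Properties using (++-assoc)
open import Data.Vec using (Vec; []; _∷_)
open import Data.Maybe.Relation.Binary.Pointwise as Maybeʷ using (just; nothing)
open import Data.Vec.Relation.Binary.Pointwise.Inductive as Vecʷ using ([]; _∷_)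
open import Data.List.Relation.Binary.Pointwise as Listʷ using ([]; _∷_)
open import Level using (Level; _⊔_)
open import Relation.Binary.Core using (Rel; _⇒_)
open import Relation.Binary.Definitions using (Reflexive)
open import Relation.Binary.PropositionalEquality using (_≡_; refl; sym; trans; cong; subst)
open import Relation.Binary.Construct.Closure.ReflexiveTransitive using (Star; ε; _◅_; _◅◅_; gmap; _⋆)
open import Relation.Binary.Rewriting using (Confluent)

module _ {a ℓ : Level} {X : Set a} where

  Diamond : Rel X ℓ → Set (a ⊔ ℓ)
  Diamond _⟶_ = ∀ {x y z} → x ⟶ y → x ⟶ z → ∃ λ w → y ⟶ w × z ⟶ w

module _ {a ℓ : Level} {X : Set a} {_⇉_ : Rel X ℓ} where

  diamond-strip : Diamond _⇉_ → ∀ {x y z} → x ⇉ y → Star _⇉_ x z → ∃ λ w → Star _⇉_ y w × z ⇉ w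
  diamond-strip ◇ p ε = _ , ε , p
  diamond-strip ◇ p (q ◅ qs) with ◇ p q
  ... | w , p′ , q′ with diamond-strip ◇ q′ qs
  ...   | w′ , ps′ , r = w′ , p′ ◅ ps′ , r

  diamond⇒conf : Diamond _⇉_ → Confluent _⇉_
  diamond⇒conf ◇ ε qs = _ , qs , ε
  diamond⇒conf ◇ (p ◅ ps) qs with diamond-strip ◇ p qs
  ... | w , qs′ , r with diamond⇒conf ◇ ps qs′
  ...   | w′ , ps′ , rs = w′ , ps′ , r ◅ rs

module _ {a ℓ₁ ℓ₂ : Level} {X : Set a} {_⟶_ : Rel X ℓ₁} {_⇉_ : Rel X ℓ₂} where

  parallel-diamond⇒conf : _⟶_ ⇒ _⇉_ → _⇉_ ⇒ Star _⟶_ → Diamond _⇉_ → Confluent _⟶_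
  parallel-diamond⇒conf ⟶⊆⇉ ⇉⊆⟶⋆ ◇ p q
    with diamond⇒conf ◇ (gmap id ⟶⊆⇉ p) (gmap id ⟶⊆⇉ q)
  ... | w , p′ , q′ = w , (⇉⊆⟶⋆ ⋆) p′ , (⇉⊆⟶⋆ ⋆) q′

module _ {ℓ : Level} {X : Set} where

  Pointwiseᴹ : Rel X ℓ → ∀ {n} → Rel (Vec (Maybe X) n) ℓ
  Pointwiseᴹ _~_ = Vecʷ.Pointwise (Maybeʷ.Pointwise _~_)

  module _ {_~_ : Rel X ℓ} where

    Pointwise-upd : ∀ {n} {R R′ : Vec X n} {x y} i →
                    Vecʷ.Pointwise _~_ R R′ → x ~ y → Vecʷ.Pointwise _~_ (upd i x R) (upd i y R′)
    Pointwise-upd i       []        q = []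
    Pointwise-upd zero    (_ ∷ ps) q = q ∷ ps
    Pointwise-upd (suc i) (p ∷ ps) q = p ∷ Pointwise-upd i ps q

    Pointwiseᴹ-upd-at : Reflexive _~_ → ∀ {n} (R : Vec (Maybe X) n) i {x y} →
                        R ! i ≡ just x → x ~ y → Pointwiseᴹ _~_ R (upd i (just y) R)
    Pointwiseᴹ-upd-at ~-refl (z ∷ R) zero    refl q = just q ∷ Vecʷ.refl (Maybeʷ.refl ~-refl)
    Pointwiseᴹ-upd-at ~-refl (z ∷ R) (suc i) e    q = Maybeʷ.refl ~-refl ∷ Pointwiseᴹ-upd-at ~-refl R i e q

    Pointwise-updₗ-at : Reflexive _~_ → ∀ (T : List X) i {x y} →
                        T !ₗ i ≡ just x → x ~ y → Listʷ.Pointwise _~_ T (updₗ i y T)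
    Pointwise-updₗ-at ~-refl (z ∷ T) zero    refl q = q ∷ Listʷ.refl ~-refl
    Pointwise-updₗ-at ~-refl (z ∷ T) (suc i) e    q = ~-refl ∷ Pointwise-updₗ-at ~-refl T i e q

    Pointwiseᴹ-! : ∀ {n} {R R′ : Vec (Maybe X) n} → Pointwiseᴹ _~_ R R′ →
                   ∀ i {x} → R ! i ≡ just x → ∃ λ y → R′ ! i ≡ just y × x ~ y
    Pointwiseᴹ-! (just p ∷ ps) zero    refl = _ , refl , p
    Pointwiseᴹ-! (_      ∷ ps) (suc i) e    = Pointwiseᴹ-! ps i e

    Pointwiseᴹ-nonEmpty : ∀ {n} {R R′ : Vec (Maybe X) n} → Pointwiseᴹ _~_ R R′ → nonEmpty R ≡ nonEmpty R′
    Pointwiseᴹ-nonEmpty ps = Vecʷ.Pointwise-≡⇒≡ (Vecʷ.map⁺ is-just-cong ps)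
      where
        is-just-cong : ∀ {x y} → Maybeʷ.Pointwise _~_ x y → is-just x ≡ is-just y
        is-just-cong (just _) = refl
        is-just-cong nothing  = refl

    data Stepᴹ {n} : Rel (Vec (Maybe X) n) ℓ where
      step-at : ∀ {R} i {x y} → R ! i ≡ just x → x ~ y → Stepᴹ R (upd i (just y) R)

    data Stepₗ : Rel (List X) ℓ where
      step-at : ∀ {T} i {x y} → T !ₗ i ≡ just x → x ~ y → Stepₗ T (updₗ i y T)

    Stepᴹ-∷ : ∀ {n} {z} {R R′ : Vec (Maybe X) n} → Stepᴹ R R′ → Stepᴹ (z ∷ R) (z ∷ R′)
    Stepᴹ-∷ (step-at i e s) = step-at (suc i) e s

    Stepₗ-∷ : ∀ {z} {T T′ : List X} → Stepₗ T T′ → Stepₗ (z ∷ T) (z ∷ T′)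
    Stepₗ-∷ (step-at i e s) = step-at (suc i) e s

    Pointwiseᴹ⋆⇒Stepᴹ⋆ : ∀ {n} {R R′ : Vec (Maybe X) n} → Pointwiseᴹ (Star _~_) R R′ → Star Stepᴹ R R′
    Pointwiseᴹ⋆⇒Stepᴹ⋆ [] = ε
    Pointwiseᴹ⋆⇒Stepᴹ⋆ (nothing ∷ ps) = gmap (nothing ∷_) Stepᴹ-∷ (Pointwiseᴹ⋆⇒Stepᴹ⋆ ps)
    Pointwiseᴹ⋆⇒Stepᴹ⋆ {R = _ ∷ R} {just y ∷ _} (just ss ∷ ps) =
      gmap (λ x → just x ∷ R) (step-at zero refl) ss ◅◅ gmap (just y ∷_) Stepᴹ-∷ (Pointwiseᴹ⋆⇒Stepᴹ⋆ ps)

    Pointwise⋆⇒Stepₗ⋆ : ∀ {T T′ : List X} → Listʷ.Pointwise (Star _~_) T T′ → Star Stepₗ T T′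
    Pointwise⋆⇒Stepₗ⋆ [] = ε
    Pointwise⋆⇒Stepₗ⋆ {_ ∷ T} {y ∷ _} (ss ∷ ps) =
      gmap (_∷ T) (step-at zero refl) ss ◅◅ gmap (y ∷_) Stepₗ-∷ (Pointwise⋆⇒Stepₗ⋆ ps)

module Confluence (A : Set) (hash : Machine A ↔ A) where
  open Reduction A hash

  #⁻¹-# : ∀ M → #⁻¹ (# M) ≡ M
  #⁻¹-# = Inverse.strictlyInverseʳ hash

  #-#⁻¹ : ∀ a → # (#⁻¹ a) ≡ a
  #-#⁻¹ = Inverse.strictlyInverseˡ hash

  mutual
    data _⇛_ : A → A → Set where
      ⇛-refl : ∀ {a} → a ⇛ a
      ⇛-code : ∀ {a N} → #⁻¹ a ⇉ N → a ⇛ # N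

    data _⇉ᵢ_ : Machine A → Machine A → Set where
      inner : ∀ {r} {R R′ : Vec (Maybe A) r} {P T T′} .{v : nonEmpty R ⊨P P} .{v′ : nonEmpty R′ ⊨P P} →
              Pointwiseᴹ _⇛_ R R′ → Listʷ.Pointwise _⇛_ T T′ →
              ⟨ r , R , P , v , T ⟩ ⇉ᵢ ⟨ r , R′ , P , v′ , T′ ⟩

    data _⇉_ : Machine A → Machine A → Set where
      ⇉-inner : ∀ {M N} → M ⇉ᵢ N → M ⇉ N
      ⇉-head  : ∀ {M M′ N} → M ⇉ᵢ M′ → M′ →h N → M ⇉ N

  ⇉ᵢ-refl : ∀ M → M ⇉ᵢ M
  ⇉ᵢ-refl ⟨ r , R , P , v , T ⟩ = inner (Vecʷ.refl (Maybeʷ.refl ⇛-refl)) (Listʷ.refl ⇛-refl)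

  ⇛-# : ∀ {M N} → M ⇉ N → # M ⇛ # N
  ⇛-# {M} {N} p = ⇛-code (subst (_⇉ N) (sym (#⁻¹-# M)) p)

  ⇛⇒⇉ : ∀ {a b} → a ⇛ b → #⁻¹ a ⇉ #⁻¹ b
  ⇛⇒⇉ {a} ⇛-refl = ⇉-inner (⇉ᵢ-refl (#⁻¹ a))
  ⇛⇒⇉ {a} (⇛-code {N = N} p) = subst (#⁻¹ a ⇉_) (sym (#⁻¹-# N)) p

  ++ₘ-assoc : ∀ (M : Machine A) T U → (M ++ₘ T) ++ₘ U ≡ M ++ₘ (T ++ U)
  ++ₘ-assoc ⟨ r , R , P , v , T₀ ⟩ T U = cong (λ T′ → ⟨ r , R , P , v , T′ ⟩) (++-assoc T₀ T U)

  →h-++ₘ : ∀ {M N} U → M →h N → (M ++ₘ U) →h (N ++ₘ U)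
  →h-++ₘ U (h-load R i P v a T) = h-load R i P v a (T ++ U)
  →h-++ₘ U (h-app R i j k P v T a b eᵢ eⱼ) = h-app R i j k P v (T ++ U) a b eᵢ eⱼ
  →h-++ₘ U (h-call {r} R i v T a e) =
    subst (⟨ r , R , apr (cpr (call i)) , v , T ++ U ⟩ →h_) (sym (++ₘ-assoc (#⁻¹ a) T U)) (h-call R i v (T ++ U) a e)

  ⇉ᵢ-++ₘ : ∀ {M N U U′} → M ⇉ᵢ N → Listʷ.Pointwise _⇛_ U U′ → (M ++ₘ U) ⇉ᵢ (N ++ₘ U′)
  ⇉ᵢ-++ₘ (inner ps qs) us = inner ps (Listʷ.++⁺ qs us)

  ⇉-++ₘ : ∀ {M N U U′} → M ⇉ N → Listʷ.Pointwise _⇛_ U U′ → (M ++ₘ U) ⇉ (N ++ₘ U′)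
  ⇉-++ₘ (⇉-inner p) us = ⇉-inner (⇉ᵢ-++ₘ p us)
  ⇉-++ₘ {U′ = U′} (⇉-head p h) us = ⇉-head (⇉ᵢ-++ₘ p us) (→h-++ₘ U′ h)

  ·-cong : ∀ {a a′ b b′} → a ⇛ a′ → b ⇛ b′ → (a · b) ⇛ (a′ · b′)
  ·-cong p q = ⇛-# (⇉-++ₘ (⇛⇒⇉ p) (q ∷ []))

  →h-⇉ᵢ-commute : ∀ {M N M′} → M →h N → M ⇉ᵢ M′ → ∃ λ N′ → M′ →h N′ × N ⇉ N′
  →h-⇉ᵢ-commute (h-load R i P v a T) (inner {R′ = R′} {v′ = v′} ps (_∷_ {y = a′} {ys = T′} q qs)) =
    _ , h-load R′ i P v′ a′ T′ , ⇉-inner (inner (Pointwise-upd i ps (just q)) qs)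
  →h-⇉ᵢ-commute (h-app R i j k P v T a b eᵢ eⱼ) (inner {R′ = R′} {T′ = T′} {v′ = v′} ps qs)
    with Pointwiseᴹ-! ps i eᵢ | Pointwiseᴹ-! ps j eⱼ
  ... | a′ , eᵢ′ , pᵢ | b′ , eⱼ′ , pⱼ =
    _ , h-app R′ i j k P v′ T′ a′ b′ eᵢ′ eⱼ′ , ⇉-inner (inner (Pointwise-upd k ps (just (·-cong pᵢ pⱼ))) qs)
  →h-⇉ᵢ-commute (h-call R i v T a e) (inner {R′ = R′} {T′ = T′} {v′ = v′} ps qs) with Pointwiseᴹ-! ps i e
  ... | a′ , e′ , p = _ , h-call R′ i v′ T′ a′ e′ , ⇉-++ₘ (⇛⇒⇉ p) qs

  →h-deterministic : ∀ {M N₁ N₂} → M →h N₁ → M →h N₂ → N₁ ≡ N₂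
  →h-deterministic (h-load _ _ _ _ _ _) (h-load _ _ _ _ _ _) = refl
  →h-deterministic (h-app _ _ _ _ _ _ _ _ _ eᵢ eⱼ) (h-app _ _ _ _ _ _ _ _ _ eᵢ′ eⱼ′)
    with trans (sym eᵢ) eᵢ′ | trans (sym eⱼ) eⱼ′
  ... | refl | refl = refl
  →h-deterministic (h-call _ _ _ _ _ e) (h-call _ _ _ _ _ e′) with trans (sym e) e′
  ... | refl = refl

  mutual
    ⇛-diamond : Diamond _⇛_
    ⇛-diamond ⇛-refl q = _ , q , ⇛-refl
    ⇛-diamond p ⇛-refl = _ , ⇛-refl , p
    ⇛-diamond (⇛-code p) (⇛-code q) with ⇉-diamond p q
    ... | Z , p′ , q′ = # Z , ⇛-# p′ , ⇛-# q′

    ⇛ᴹ-diamond : ∀ {n} → Diamond (Pointwiseᴹ _⇛_ {n})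
    ⇛ᴹ-diamond [] [] = [] , [] , []
    ⇛ᴹ-diamond (nothing ∷ ps) (nothing ∷ qs) with ⇛ᴹ-diamond ps qs
    ... | W , ps′ , qs′ = nothing ∷ W , nothing ∷ ps′ , nothing ∷ qs′
    ⇛ᴹ-diamond (just p ∷ ps) (just q ∷ qs) with ⇛-diamond p q | ⇛ᴹ-diamond ps qs
    ... | w , p′ , q′ | W , ps′ , qs′ = just w ∷ W , just p′ ∷ ps′ , just q′ ∷ qs′

    ⇛ₗ-diamond : Diamond (Listʷ.Pointwise _⇛_)
    ⇛ₗ-diamond [] [] = [] , [] , []
    ⇛ₗ-diamond (p ∷ ps) (q ∷ qs) with ⇛-diamond p q | ⇛ₗ-diamond ps qs
    ... | w , p′ , q′ | W , ps′ , qs′ = w ∷ W , p′ ∷ ps′ , q′ ∷ qs′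

    ⇉ᵢ-diamond : Diamond _⇉ᵢ_
    ⇉ᵢ-diamond (inner {r} {P = P} {v = v} ps qs) (inner ps′ qs′)
      with ⇛ᴹ-diamond ps ps′ | ⇛ₗ-diamond qs qs′
    ... | W , ps₁ , ps₂ | U , qs₁ , qs₂ =
      ⟨ r , W , P , subst (_⊨P P) (trans (Pointwiseᴹ-nonEmpty ps) (Pointwiseᴹ-nonEmpty ps₁)) v , U ⟩
      , inner ps₁ qs₁ , inner ps₂ qs₂

    ⇉-diamond : Diamond _⇉_
    ⇉-diamond (⇉-inner p) (⇉-inner q) with ⇉ᵢ-diamond p q
    ... | Z , p′ , q′ = Z , ⇉-inner p′ , ⇉-inner q′
    ⇉-diamond (⇉-inner p) (⇉-head q h) with ⇉ᵢ-diamond p q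
    ... | Z , p′ , q′ with →h-⇉ᵢ-commute h q′
    ...   | Z′ , h′ , r = Z′ , ⇉-head p′ h′ , r
    ⇉-diamond (⇉-head p h) (⇉-inner q) with ⇉ᵢ-diamond p q
    ... | Z , p′ , q′ with →h-⇉ᵢ-commute h p′
    ...   | Z′ , h′ , r = Z′ , r , ⇉-head q′ h′
    ⇉-diamond (⇉-head p h) (⇉-head q k) with ⇉ᵢ-diamond p q
    ... | Z , p′ , q′ with →h-⇉ᵢ-commute h p′ | →h-⇉ᵢ-commute k q′
    ...   | Z₁ , h₁ , r₁ | Z₂ , h₂ , r₂ with →h-deterministic h₁ h₂
    ...     | refl = Z₁ , r₁ , r₂

  →c⇒⇉ : _→c_ ⇒ _⇉_
  →c⇒⇉ (c-head {M} h) = ⇉-head (⇉ᵢ-refl M) h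
  →c⇒⇉ (c-reg R P v T i a M′ e s) =
    ⇉-inner (inner (Pointwiseᴹ-upd-at ⇛-refl R i e (⇛-code (→c⇒⇉ s))) (Listʷ.refl ⇛-refl))
  →c⇒⇉ (c-tape R P v T i a M′ e s) =
    ⇉-inner (inner (Vecʷ.refl (Maybeʷ.refl ⇛-refl)) (Pointwise-updₗ-at ⇛-refl T i e (⇛-code (→c⇒⇉ s))))

  -- The rewriting that c-reg and c-tape apply to a single register or tape cell.
  data _→ₐ_ (a : A) : A → Set where
    code-step : ∀ {N} → #⁻¹ a →c N → a →ₐ # N

  ↠c⇒→ₐ⋆ : ∀ {M N} → M ↠c N → Star _→ₐ_ (# M) (# N)
  ↠c⇒→ₐ⋆ = gmap # (λ {M} s → code-step (subst (_→c _) (sym (#⁻¹-# M)) s))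

  Stepᴹ⋆-lift : ∀ {r} {R R′ : Vec (Maybe A) r} {P T} → Star (Stepᴹ {_~_ = _→ₐ_}) R R′ →
                .(v : nonEmpty R ⊨P P) .(v′ : nonEmpty R′ ⊨P P) → ⟨ r , R , P , v , T ⟩ ↠c ⟨ r , R′ , P , v′ , T ⟩
  Stepᴹ⋆-lift ε v v′ = ε
  Stepᴹ⋆-lift {R = R} {P = P} (step-at i {x = a} e (code-step {N} s) ◅ ss) v v′ =
    c-reg R P v _ i a N e s ◅ Stepᴹ⋆-lift ss (subst (_⊨P P) (sym (nonEmpty-upd-just i (# N) a R e)) v) v′

  Stepₗ⋆-lift : ∀ {r} {R : Vec (Maybe A) r} {P T T′} → Star (Stepₗ {_~_ = _→ₐ_}) T T′ →
                .(v : nonEmpty R ⊨P P) → ⟨ r , R , P , v , T ⟩ ↠c ⟨ r , R , P , v , T′ ⟩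
  Stepₗ⋆-lift ε v = ε
  Stepₗ⋆-lift (step-at i e (code-step s) ◅ ss) v = c-tape _ _ v _ i _ _ e s ◅ Stepₗ⋆-lift ss v

  mutual
    ⇛⇒→ₐ⋆ : ∀ {a b} → a ⇛ b → Star _→ₐ_ a b
    ⇛⇒→ₐ⋆ ⇛-refl = ε
    ⇛⇒→ₐ⋆ {a} (⇛-code p) = subst (λ a₀ → Star _→ₐ_ a₀ _) (#-#⁻¹ a) (↠c⇒→ₐ⋆ (⇉⇒↠c p))

    ⇛ᴹ⇒→ₐ⋆ : ∀ {n} {R R′ : Vec (Maybe A) n} → Pointwiseᴹ _⇛_ R R′ → Pointwiseᴹ (Star _→ₐ_) R R′
    ⇛ᴹ⇒→ₐ⋆ [] = []
    ⇛ᴹ⇒→ₐ⋆ (nothing ∷ ps) = nothing ∷ ⇛ᴹ⇒→ₐ⋆ ps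
    ⇛ᴹ⇒→ₐ⋆ (just p ∷ ps) = just (⇛⇒→ₐ⋆ p) ∷ ⇛ᴹ⇒→ₐ⋆ ps

    ⇛ₗ⇒→ₐ⋆ : ∀ {T T′} → Listʷ.Pointwise _⇛_ T T′ → Listʷ.Pointwise (Star _→ₐ_) T T′
    ⇛ₗ⇒→ₐ⋆ [] = []
    ⇛ₗ⇒→ₐ⋆ (p ∷ ps) = ⇛⇒→ₐ⋆ p ∷ ⇛ₗ⇒→ₐ⋆ ps

    ⇉ᵢ⇒↠c : _⇉ᵢ_ ⇒ _↠c_
    ⇉ᵢ⇒↠c (inner {v = v} {v′} ps qs) =
      Stepᴹ⋆-lift (Pointwiseᴹ⋆⇒Stepᴹ⋆ (⇛ᴹ⇒→ₐ⋆ ps)) v v′ ◅◅ Stepₗ⋆-lift (Pointwise⋆⇒Stepₗ⋆ (⇛ₗ⇒→ₐ⋆ qs)) v′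

    ⇉⇒↠c : _⇉_ ⇒ _↠c_
    ⇉⇒↠c (⇉-inner p) = ⇉ᵢ⇒↠c p
    ⇉⇒↠c (⇉-head p h) = ⇉ᵢ⇒↠c p ◅◅ (c-head h ◅ ε)

  →c-confluent : Confluent _→c_
  →c-confluent = parallel-diamond⇒conf →c⇒⇉ ⇉⇒↠c ⇉-diamond

proposition3p9 : (A : Set) → (A ↣ ℕ) → (hash : Machine A ↔ A) →
    (M M₁ M₂ : Machine A) →
    Reduction._↠c_ A hash M M₁ → Reduction._↠c_ A hash M M₂ →
    Σ (Machine A) (λ Z → Reduction._↠c_ A hash M₁ Z × Reduction._↠c_ A hash M₂ Z)
proposition3p9 A _ hash M M₁ M₂ = Confluence.→c-confluent A hash
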